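{- For every $w\in S_n$, $\mathcal{S}_{\mathsf{D}_w}\supseteq\mathsf{Newton}(\mathfrak{K}_w)$.
   Context: A diagram $\mathsf{D}$ is a subset of the $n\times n$ grid, $(r,c)$ meaning row $r$ (numbered top to bottom), column $c$. The Rothe diagram of $w\in S_n$ is $\mathsf{D}_w=\{(i,j):w(i)>j\text{ and }w^{ -1}(j)>i\}$. For $S\subseteq[n]$ and column $c$, $\mathtt{word}_{c,S}(\mathsf{D})$ reads rows $1,\ldots,n$ of column $c$ recording "(" if $(r,c)\notin\mathsf{D}$, $r\in S$; ")" if $(r,c)\in\mathsf{D}$, $r\notin S$; "$\star$" if $(r,c)\in\mathsf{D}$, $r\in S$; nothing otherwise. $\theta^c_{\mathsf{D}}(S)$ is the number of matched "()" pairs (usual parenthesis matching, ignoring $\star$) plus the number of $\star$'s, and $\theta_{\mathsf{D}}(S)=\sum_c\theta^c_{\mathsf{D}}(S)$. The Schubitope is $\mathcal{S}_{\mathsf{D}}=\{\alpha\in\mathbb{R}^n_{\geq0}:\sum_{i=1}^n\alpha_i=\#\mathsf{D},\ \sum_{i\in S}\alpha_i\leq\theta_{\mathsf{D}}(S)\text{ for all }S\subseteq[n]\}$. A Kohnert move on a diagram $D$: choose a row containing a box, take its rightmost box $(r,c)$, and if some $(r',c)\notin D$ with $r'<r$ exists, move the box to $(r',c)$ for the largest such $r'$. $\mathsf{Koh}(w)$ is the set of diagrams obtainable from $\mathsf{D}_w$ by finite sequences of Kohnert moves (including $\mathsf{D}_w$ itself). $\mathfrak{K}_w=\sum_{D\in\mathsf{Koh}(w)}\prod_i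 x_i^{\#\{\text{boxes of }D\text{ in row }i\}}$. $\mathsf{Newton}(f)$ is the convex hull of exponent vectors of $f$ in $\mathbb{R}^n$.
   Formalization: Points of $\mathsf{Newton}(\mathfrak{K}_w)$ and of $\mathcal{S}_{\mathsf{D}_w}$ have rational coordinates rather than real ones, and the convex-combination coefficients are rational. -}

module Defs where

open import Data.Nat as ℕ using (ℕ; zero; suc)
open import Data.Bool using (Bool; true; false; if_then_else_; _∧_)
open import Data.Fin as Fin using (Fin; _≟_)
open import Data.Fin.Properties as FinP using ()
open import Data.Fin.Permutation using (Permutation′; _⟨$⟩ʳ_; _⟨$⟩ˡ_)
open import Data.Fin.Subset using (Subset)
open import Data.Vec using (lookup)
open import Data.List using (List; []; _∷_; map; allFin; foldr; _++_)
open import Data.List.Relation.Unary.All using (All)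
open import Data.Product using (_×_; _,_; proj₁; proj₂; Σ; ∃)
open import Data.Rational as ℚ using (ℚ; 0ℚ; 1ℚ)
open import Data.Integer using (+_)
open import Relation.Nullary.Decidable using (⌊_⌋)
open import Relation.Binary.PropositionalEquality using (_≡_)

-- A diagram in the n×n grid: D r c = true iff the cell (row r, column c) is a box.
-- Rows/columns are indexed by Fin n (row 0 = top row, i.e. row 1 of the paper).
Diagram : ℕ → Set
Diagram n = Fin n → Fin n → Bool

rothe : ∀ {n} → Permutation′ n → Diagram n
rothe w i j = ⌊ j Fin.<? (w ⟨$⟩ʳ i) ⌋ ∧ ⌊ i Fin.<? (w ⟨$⟩ˡ j) ⌋

ΣFin : ∀ n → (Fin n → ℕ) → ℕ
ΣFin n f = foldr (λ i acc → f i ℕ.+ acc) 0 (allFin n)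

Σℚ : List ℚ → ℚ
Σℚ = foldr ℚ._+_ 0ℚ

rowCount : ∀ {n} → Diagram n → Fin n → ℕ
rowCount {n} D r = ΣFin n (λ c → if D r c then 1 else 0)

size : ∀ {n} → Diagram n → ℕ
size {n} D = ΣFin n (rowCount D)

-- exponent vector (weight) of a diagram: x^{wt D} = ∏_i x_i^{#boxes in row i}
wt : ∀ {n} → Diagram n → Fin n → ℕ
wt = rowCount

data Sym : Set where
  open′ close′ star : Sym

wordAt : ∀ {n} → Diagram n → Subset n → Fin n → Fin n → List Sym
wordAt D S c r with D r c | lookup S r
... | false | true  = open′ ∷ []
... | true  | false = close′ ∷ []
... | true  | true  = star ∷ []
... | false | false = []

word : ∀ {n} → Fin n → Diagram n → Subset n → List Sym
word {n} c D S = foldr (λ r acc → wordAt D S c r ++ acc) [] (allFin n)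

-- number of matched "()" pairs under usual parenthesis matching (stars ignored);
-- the accumulator k is the number of currently unmatched "("
matched : ℕ → List Sym → ℕ
matched k []             = 0
matched k (open′  ∷ ws)  = matched (suc k) ws
matched zero (close′ ∷ ws)    = matched zero ws
matched (suc k) (close′ ∷ ws) = suc (matched k ws)
matched k (star   ∷ ws)  = matched k ws

stars : List Sym → ℕ
stars []            = 0
stars (star ∷ ws)   = suc (stars ws)
stars (open′ ∷ ws)  = stars ws
stars (close′ ∷ ws) = stars ws

θcol : ∀ {n} → Diagram n → Subset n → Fin n → ℕ
θcol D S c = matched 0 (word c D S) ℕ.+ stars (word c D S)

θ : ∀ {n} → Diagram n → Subset n → ℕ
θ {n} D S = ΣFin n (θcol D S)

ℕtoℚ : ℕ → ℚ
ℕtoℚ k = (+ k) ℚ./ 1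

ΣℚFin : ∀ n → (Fin n → ℚ) → ℚ
ΣℚFin n f = Σℚ (map f (allFin n))

ΣℚIn : ∀ {n} → Subset n → (Fin n → ℚ) → ℚ
ΣℚIn {n} S α = ΣℚFin n (λ i → if lookup S i then α i else 0ℚ)

InSchubitope : ∀ {n} → Diagram n → (Fin n → ℚ) → Set
InSchubitope {n} D α =
  (∀ i → 0ℚ ℚ.≤ α i)
  × ΣℚFin n α ≡ ℕtoℚ (size D)
  × (∀ (S : Subset n) → ΣℚIn S α ℚ.≤ ℕtoℚ (θ D S))

moveBox : ∀ {n} → Diagram n → Fin n → Fin n → Fin n → Diagram n
moveBox D r c r' i j =
  if ⌊ j ≟ c ⌋ ∧ ⌊ i ≟ r ⌋ then false
  else if ⌊ j ≟ c ⌋ ∧ ⌊ i ≟ r' ⌋ then true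
  else D i j

record KohnertMove {n} (D E : Diagram n) : Set where
  field
    r c r'      : Fin n
    box         : D r c ≡ true
    rightmost   : ∀ c' → c Fin.< c' → D r c' ≡ false
    above       : r' Fin.< r
    empty       : D r' c ≡ false
    largest     : ∀ r'' → r' Fin.< r'' → r'' Fin.< r → D r'' c ≡ true
    result      : ∀ i j → E i j ≡ moveBox D r c r' i j

-- Koh(w): diagrams reachable from D_w by finitely many Kohnert moves
-- (diagrams are identified up to pointwise equality)
data Koh {n} (w : Permutation′ n) : Diagram n → Set where
  start : ∀ {D} → (∀ i j → D i j ≡ rothe w i j) → Koh w D
  step  : ∀ {D E} → Koh w D → KohnertMove D E → Koh w E

-- Newton(𝔎_w): the exponent vectors of 𝔎_w are exactly the weights wt D,
-- D ∈ Koh(w) (all coefficients are positive).  A point (with rational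
-- coordinates) of the convex hull is a convex combination of them.

InNewtonKoh : ∀ {n} → Permutation′ n → (Fin n → ℚ) → Set
InNewtonKoh {n} w α =
  Σ (List (ℚ × Diagram n)) λ comb →
      All (λ p → (0ℚ ℚ.≤ proj₁ p) × Koh w (proj₂ p)) comb
    × Σℚ (map proj₁ comb) ≡ 1ℚ
    × (∀ i → α i ≡ Σℚ (map (λ p → proj₁ p ℚ.* ℕtoℚ (wt (proj₂ p) i)) comb))

module Submission where

-- The exponent vectors of 𝔎_w are the row-weights wt D of the diagrams
-- D ∈ Koh(w).  The proof has three parts.
--  (1) Kohnert moves preserve the number of boxes and never increase θ(S):
--      a move only changes one column c, where a box at row r jumps to the
--      empty row r' < r over a block of boxes, and a case analysis on the
--      parenthesis word of column c (ParenthesisWords, ColumnWords) shows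
--      the count of matched pairs plus stars cannot grow.  Hence
--      #D = #D_w and θ_D(S) ≤ θ_{D_w}(S) for every D ∈ Koh(w).
--  (2) For any diagram D, the boxes of D in rows of S are exactly the stars
--      of the column words, so Σ_{i∈S} wt(D)_i ≤ θ_D(S).
--  (3) Together, each wt D with D ∈ Koh(w) lies in the Schubitope of D_w;
--      the Schubitope is cut out by linear inequalities, so it is convex
--      and contains every rational convex combination of these points.

open import Defs
open import Data.Nat as ℕ using (ℕ; zero; suc; z≤n; s≤s)
import Data.Nat.Properties as ℕP
open import Data.Bool using (Bool; true; false; if_then_else_; _∧_)
open import Data.Fin as Fin using (Fin; _≟_)
import Data.Fin.Properties as FinP
open import Data.Fin.Permutation using (Permutation′)
open import Data.Fin.Subset using (Subset)
open import Data.Vec using (lookup)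
open import Data.List using (List; []; _∷_; _++_; foldr; allFin; map)
open import Data.List.Properties using (++-assoc)
open import Data.List.Relation.Unary.All as All using (All; []; _∷_)
import Data.List.Relation.Unary.All.Properties as AllP
open import Data.List.Relation.Unary.AllPairs using (AllPairs; []; _∷_)
import Data.List.Relation.Unary.AllPairs.Properties as AllPairsP
open import Data.List.Membership.Propositional using (_∈_)
open import Data.List.Membership.Propositional.Properties using (∈-allFin; ∈-++⁻)
open import Data.List.Relation.Unary.Any using (here; there)
open import Data.Product using (_×_; _,_; proj₁; proj₂; ∃; ∃₂)
open import Data.Sum using (inj₁; inj₂)
open import Data.Empty using (⊥-elim)
open import Relation.Nullary using (yes; no)
open import Relation.Nullary.Decidable using (⌊_⌋)
open import Relation.Binary.PropositionalEquality
import Data.Integer as ℤ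
import Data.Integer.Properties as ℤP
open import Data.Rational as ℚ using (ℚ; mkℚ; 0ℚ; 1ℚ; *≤*)
import Data.Rational.Properties as ℚP
import Data.Nat.Coprimality as Coprimality
open import Algebra.Bundles using (CommutativeMonoid)
import Algebra.Properties.CommutativeSemigroup as CommSemigroupProps

ind : Bool → ℕ
ind b = if b then 1 else 0

module NatSums where
  open import Data.Nat using (_+_; _≤_)
  open CommSemigroupProps ℕP.+-commutativeSemigroup using (interchange)

  Σℕ : {A : Set} → List A → (A → ℕ) → ℕ
  Σℕ xs f = foldr (λ x acc → f x + acc) 0 xs

  Σℕ-cong : {A : Set} (xs : List A) {f g : A → ℕ} → (∀ x → f x ≡ g x) → Σℕ xs f ≡ Σℕ xs g
  Σℕ-cong []       f≡g = refl
  Σℕ-cong (x ∷ xs) f≡g = cong₂ _+_ (f≡g x) (Σℕ-cong xs f≡g)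

  Σℕ-mono : {A : Set} (xs : List A) {f g : A → ℕ} → (∀ x → f x ≤ g x) → Σℕ xs f ≤ Σℕ xs g
  Σℕ-mono []       f≤g = z≤n
  Σℕ-mono (x ∷ xs) f≤g = ℕP.+-mono-≤ (f≤g x) (Σℕ-mono xs f≤g)

  Σℕ-zero : {A : Set} (xs : List A) (f : A → ℕ) → All (λ x → f x ≡ 0) xs → Σℕ xs f ≡ 0
  Σℕ-zero []       f []          = refl
  Σℕ-zero (x ∷ xs) f (fx≡0 ∷ zs) rewrite fx≡0 = Σℕ-zero xs f zs

  Σℕ-+ : {A : Set} (xs : List A) (f g : A → ℕ) → Σℕ xs (λ x → f x + g x) ≡ Σℕ xs f + Σℕ xs g
  Σℕ-+ []       f g = refl
  Σℕ-+ (x ∷ xs) f g rewrite Σℕ-+ xs f g = interchange (f x) (g x) (Σℕ xs f) (Σℕ xs g)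

  Σℕ-++ : {A : Set} (xs ys : List A) (f : A → ℕ) → Σℕ (xs ++ ys) f ≡ Σℕ xs f + Σℕ ys f
  Σℕ-++ []       ys f = refl
  Σℕ-++ (x ∷ xs) ys f rewrite Σℕ-++ xs ys f = sym (ℕP.+-assoc (f x) _ _)

  Σℕ-swap : {A B : Set} (xs : List A) (ys : List B) (f : A → B → ℕ) →
    Σℕ xs (λ x → Σℕ ys (f x)) ≡ Σℕ ys (λ y → Σℕ xs (λ x → f x y))
  Σℕ-swap []       ys f = sym (Σℕ-zero ys _ (All.universal (λ _ → refl) ys))
  Σℕ-swap (x ∷ xs) ys f rewrite Σℕ-swap xs ys f = sym (Σℕ-+ ys (f x) _)

  ΣℕIn : ∀ {n} → Subset n → (Fin n → ℕ) → ℕ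
  ΣℕIn {n} S f = Σℕ (allFin n) (λ i → if lookup S i then f i else 0)

open NatSums

-- The list 0,1,…,n-1 is strictly increasing, so it splits uniquely around
-- any element, and around any two elements r' < r.
module FinEnumeration where

  split-sorted : ∀ {n} {x : Fin n} {xs} → x ∈ xs → AllPairs Fin._<_ xs →
    ∃₂ λ P R → xs ≡ P ++ x ∷ R × All (Fin._< x) P × All (x Fin.<_) R × AllPairs Fin._<_ R
  split-sorted {xs = y ∷ ys} (here refl) (y< ∷ sorted) = [] , ys , refl , [] , y< , sorted
  split-sorted {xs = y ∷ ys} (there x∈) (y< ∷ sorted) with split-sorted x∈ sorted
  ... | P , R , eq , P<x , x<R , sortedR =
    y ∷ P , R , cong (y ∷_) eq , All.lookup y< x∈ ∷ P<x , x<R , sortedR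

  allFin-sorted : ∀ n → AllPairs Fin._<_ (allFin n)
  allFin-sorted n = AllPairsP.tabulate⁺-< (λ i<j → i<j)

  allFin-around : ∀ {n} (x : Fin n) →
    ∃₂ λ P R → allFin n ≡ P ++ x ∷ R × All (Fin._< x) P × All (x Fin.<_) R
  allFin-around {n} x with split-sorted (∈-allFin x) (allFin-sorted n)
  ... | P , R , eq , P<x , x<R , _ = P , R , eq , P<x , x<R

  allFin-around₂ : ∀ {n} (r' r : Fin n) → r' Fin.< r →
    ∃₂ λ P Q → ∃ λ R → allFin n ≡ P ++ r' ∷ (Q ++ r ∷ R)
      × All (Fin._< r') P × All (λ q → r' Fin.< q × q Fin.< r) Q × All (r Fin.<_) R
  allFin-around₂ {n} r' r r'<r with split-sorted (∈-allFin r') (allFin-sorted n)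
  ... | P , R₁ , eq₁ , P<r' , r'<R₁ , sortedR₁ with ∈-++⁻ P (subst (r ∈_) eq₁ (∈-allFin r))
  ...   | inj₁ r∈P          = ⊥-elim (FinP.<-asym r'<r (All.lookup P<r' r∈P))
  ...   | inj₂ (here r≡r')  = ⊥-elim (FinP.<-irrefl (sym r≡r') r'<r)
  ...   | inj₂ (there r∈R₁) with split-sorted r∈R₁ sortedR₁
  ...     | Q , R , eq₂ , Q<r , r<R , _ =
    P , Q , R , trans eq₁ (cong (λ z → P ++ r' ∷ z) eq₂) , P<r' ,
    All.zip (AllP.++⁻ˡ Q (subst (All (r' Fin.<_)) eq₂ r'<R₁) , Q<r) , r<R

  delta-off : ∀ {n} {j x : Fin n} → j ≢ x → ind ⌊ j ≟ x ⌋ ≡ 0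
  delta-off {j = j} {x} j≢x with j ≟ x
  ... | yes j≡x = ⊥-elim (j≢x j≡x)
  ... | no _    = refl

  Σℕ-delta : ∀ {n} (x : Fin n) → Σℕ (allFin n) (λ j → ind ⌊ j ≟ x ⌋) ≡ 1
  Σℕ-delta {n} x with allFin-around x
  ... | P , R , eq , P<x , x<R rewrite eq
    | Σℕ-++ P (x ∷ R) (λ j → ind ⌊ j ≟ x ⌋)
    | Σℕ-zero P (λ j → ind ⌊ j ≟ x ⌋) (All.map (λ j<x → delta-off (FinP.<⇒≢ j<x)) P<x)
    | Σℕ-zero R (λ j → ind ⌊ j ≟ x ⌋) (All.map (λ x<j → delta-off (≢-sym (FinP.<⇒≢ x<j))) x<R)
    | ≡-≟-identity _≟_ {x} refl = refl

  Σℕ-delta-if : ∀ {n} (b : Bool) (x : Fin n) → Σℕ (allFin n) (λ j → ind (b ∧ ⌊ j ≟ x ⌋)) ≡ ind b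
  Σℕ-delta-if {n} false x = Σℕ-zero (allFin n) _ (All.universal (λ _ → refl) (allFin n))
  Σℕ-delta-if true  x = Σℕ-delta x

open FinEnumeration

module ParenthesisWords where
  open import Data.Nat using (_+_; _≤_)

  Θ : ℕ → List Sym → ℕ
  Θ k ws = matched k ws + stars ws

  matched-pending : ∀ k ws → matched (suc k) ws ≤ suc (matched k ws)
  matched-pending k       []            = z≤n
  matched-pending k       (open′ ∷ ws)  = matched-pending (suc k) ws
  matched-pending zero    (close′ ∷ ws) = ℕP.≤-refl
  matched-pending (suc k) (close′ ∷ ws) = s≤s (matched-pending k ws)
  matched-pending k       (star ∷ ws)   = matched-pending k ws

  matched-insert-close : ∀ k B C → matched k (B ++ C) ≤ matched k (B ++ close′ ∷ C)
  matched-insert-close zero    []            C = ℕP.≤-refl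
  matched-insert-close (suc k) []            C = matched-pending k C
  matched-insert-close k       (open′ ∷ B)   C = matched-insert-close (suc k) B C
  matched-insert-close zero    (close′ ∷ B)  C = matched-insert-close zero B C
  matched-insert-close (suc k) (close′ ∷ B)  C = s≤s (matched-insert-close k B C)
  matched-insert-close k       (star ∷ B)    C = matched-insert-close k B C

  matched-advance-open : ∀ k B C → matched k (B ++ open′ ∷ C) ≤ matched (suc k) (B ++ C)
  matched-advance-open k       []           C = ℕP.≤-refl
  matched-advance-open k       (open′ ∷ B)  C = matched-advance-open (suc k) B C
  matched-advance-open zero    (close′ ∷ B) C =
    ℕP.≤-trans (matched-advance-open zero B C) (matched-pending zero (B ++ C))
  matched-advance-open (suc k) (close′ ∷ B) C = s≤s (matched-advance-open k B C)
  matched-advance-open k       (star ∷ B)   C = matched-advance-open k B C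

  matched-delay-close : ∀ k B C → matched k (close′ ∷ B ++ C) ≤ matched k (B ++ close′ ∷ C)
  matched-delay-close k       []           C = ℕP.≤-refl
  matched-delay-close zero    (x ∷ B)      C = matched-insert-close zero (x ∷ B) C
  matched-delay-close (suc k) (open′ ∷ B)  C = matched-delay-close (suc (suc k)) B C
  matched-delay-close (suc k) (close′ ∷ B) C = s≤s (matched-delay-close k B C)
  matched-delay-close (suc k) (star ∷ B)   C = matched-delay-close (suc k) B C

  -- Symbols of a column segment consisting of boxes only.
  data Closing : Sym → Set where
    close-closing : Closing close′
    star-closing  : Closing star

  matched-bracket-closing : ∀ k B C → All Closing B →
    suc (matched k (B ++ C)) ≤ matched (suc k) (B ++ close′ ∷ C)
  matched-bracket-closing k       []           C _ = ℕP.≤-refl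
  matched-bracket-closing zero    (close′ ∷ B) C _ = s≤s (matched-insert-close zero B C)
  matched-bracket-closing (suc k) (close′ ∷ B) C (_ ∷ cl) = s≤s (matched-bracket-closing k B C cl)
  matched-bracket-closing k       (star ∷ B)   C (_ ∷ cl) = matched-bracket-closing k B C cl
  matched-bracket-closing k       (open′ ∷ B)  C (() ∷ _)

  matched-delete-close-open : ∀ k B C → matched k (close′ ∷ B ++ open′ ∷ C) ≤ suc (matched k (B ++ C))
  matched-delete-close-open zero    B C =
    ℕP.≤-trans (matched-advance-open zero B C) (matched-pending zero (B ++ C))
  matched-delete-close-open (suc k) B C = s≤s (matched-advance-open k B C)

  stars-++ : ∀ A B → stars (A ++ B) ≡ stars A + stars B
  stars-++ []            B = refl
  stars-++ (open′ ∷ A)   B = stars-++ A B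
  stars-++ (close′ ∷ A)  B = stars-++ A B
  stars-++ (star ∷ A)    B = cong suc (stars-++ A B)

  matched-skip-star : ∀ k B C → matched k (B ++ star ∷ C) ≡ matched k (B ++ C)
  matched-skip-star k       []           C = refl
  matched-skip-star k       (open′ ∷ B)  C = matched-skip-star (suc k) B C
  matched-skip-star zero    (close′ ∷ B) C = matched-skip-star zero B C
  matched-skip-star (suc k) (close′ ∷ B) C = cong suc (matched-skip-star k B C)
  matched-skip-star k       (star ∷ B)   C = matched-skip-star k B C

  Θ-prefix : ∀ A {X Y} → (∀ k → Θ k X ≤ Θ k Y) → ∀ k → Θ k (A ++ X) ≤ Θ k (A ++ Y)
  Θ-prefix []           X≤Y k       = X≤Y k
  Θ-prefix (open′ ∷ A)  X≤Y k       = Θ-prefix A X≤Y (suc k)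
  Θ-prefix (close′ ∷ A) X≤Y zero    = Θ-prefix A X≤Y zero
  Θ-prefix (close′ ∷ A) X≤Y (suc k) = s≤s (Θ-prefix A X≤Y k)
  Θ-prefix (star ∷ A)   {X} {Y} X≤Y k
    rewrite ℕP.+-suc (matched k (A ++ X)) (stars (A ++ X))
          | ℕP.+-suc (matched k (A ++ Y)) (stars (A ++ Y)) = s≤s (Θ-prefix A X≤Y k)

  cellSym : (box inS : Bool) → List Sym
  cellSym false true  = open′ ∷ []
  cellSym true  false = close′ ∷ []
  cellSym true  true  = star ∷ []
  cellSym false false = []

  -- The effect of a Kohnert move on one column word: the cell at r' (before
  -- the block B of boxes) becomes a box and the cell at r (after B) becomes
  -- empty.  This never increases Θ.
  Θ-kohnert-exchange : ∀ s' s A B C → All Closing B →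
    Θ 0 (A ++ (cellSym true s' ++ (B ++ (cellSym false s ++ C)))) ≤
    Θ 0 (A ++ (cellSym false s' ++ (B ++ (cellSym true s ++ C))))
  Θ-kohnert-exchange true  true  A B C _  = Θ-prefix A star-open 0
    where
    star-open : ∀ k → Θ k (star ∷ B ++ open′ ∷ C) ≤ Θ k (open′ ∷ B ++ star ∷ C)
    star-open k rewrite stars-++ B (open′ ∷ C) | stars-++ B (star ∷ C) | matched-skip-star (suc k) B C =
      ℕP.+-mono-≤ (matched-advance-open k B C) (ℕP.≤-reflexive (sym (ℕP.+-suc (stars B) (stars C))))
  Θ-kohnert-exchange true  false A B C cl = Θ-prefix A star-nothing 0
    where
    star-nothing : ∀ k → Θ k (star ∷ B ++ C) ≤ Θ k (open′ ∷ B ++ close′ ∷ C)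
    star-nothing k rewrite stars-++ B C | stars-++ B (close′ ∷ C)
      | ℕP.+-suc (matched k (B ++ C)) (stars B + stars C) =
      ℕP.+-monoˡ-≤ (stars B + stars C) (matched-bracket-closing k B C cl)
  Θ-kohnert-exchange false true  A B C _  = Θ-prefix A nothing-open 0
    where
    nothing-open : ∀ k → Θ k (close′ ∷ B ++ open′ ∷ C) ≤ Θ k (B ++ star ∷ C)
    nothing-open k rewrite stars-++ B (open′ ∷ C) | stars-++ B (star ∷ C) | matched-skip-star k B C
      | ℕP.+-suc (stars B) (stars C) | ℕP.+-suc (matched k (B ++ C)) (stars B + stars C) =
      ℕP.+-monoˡ-≤ (stars B + stars C) (matched-delete-close-open k B C)
  Θ-kohnert-exchange false false A B C _  = Θ-prefix A close-later 0
    where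
    close-later : ∀ k → Θ k (close′ ∷ B ++ C) ≤ Θ k (B ++ close′ ∷ C)
    close-later k rewrite stars-++ B C | stars-++ B (close′ ∷ C) =
      ℕP.+-monoˡ-≤ (stars B + stars C) (matched-delay-close k B C)

open ParenthesisWords

module ColumnWords where
  open import Data.Nat using (_+_; _≤_)

  wordAt-cellSym : ∀ {n} (D : Diagram n) S c r → wordAt D S c r ≡ cellSym (D r c) (lookup S r)
  wordAt-cellSym D S c r with D r c | lookup S r
  ... | false | true  = refl
  ... | true  | false = refl
  ... | true  | true  = refl
  ... | false | false = refl

  readColumn : ∀ {n} → Diagram n → Subset n → Fin n → List (Fin n) → List Sym
  readColumn D S c rows = foldr (λ r acc → wordAt D S c r ++ acc) [] rows

  readColumn-++ : ∀ {n} (D : Diagram n) S c xs ys →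
    readColumn D S c (xs ++ ys) ≡ readColumn D S c xs ++ readColumn D S c ys
  readColumn-++ D S c []       ys = refl
  readColumn-++ D S c (x ∷ xs) ys rewrite readColumn-++ D S c xs ys = sym (++-assoc (wordAt D S c x) _ _)

  readColumn-cong : ∀ {n} (D E : Diagram n) S c xs →
    All (λ i → E i c ≡ D i c) xs → readColumn E S c xs ≡ readColumn D S c xs
  readColumn-cong D E S c []       [] = refl
  readColumn-cong D E S c (x ∷ xs) (Ex≡Dx ∷ same)
    rewrite wordAt-cellSym E S c x | wordAt-cellSym D S c x | Ex≡Dx | readColumn-cong D E S c xs same = refl

  readColumn-boxes : ∀ {n} (D : Diagram n) S c xs →
    All (λ i → D i c ≡ true) xs → All Closing (readColumn D S c xs)
  readColumn-boxes D S c []       [] = []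
  readColumn-boxes D S c (x ∷ xs) (box ∷ boxes) rewrite wordAt-cellSym D S c x | box with lookup S x
  ... | true  = star-closing ∷ readColumn-boxes D S c xs boxes
  ... | false = close-closing ∷ readColumn-boxes D S c xs boxes

  readColumn-around₂ : ∀ {n} (F : Diagram n) S c P a Q b R →
    readColumn F S c (P ++ a ∷ (Q ++ b ∷ R)) ≡
    readColumn F S c P ++ (cellSym (F a c) (lookup S a) ++ (readColumn F S c Q ++
      (cellSym (F b c) (lookup S b) ++ readColumn F S c R)))
  readColumn-around₂ F S c P a Q b R
    rewrite readColumn-++ F S c P (a ∷ (Q ++ b ∷ R)) | readColumn-++ F S c Q (b ∷ R)
          | wordAt-cellSym F S c a | wordAt-cellSym F S c b = refl

  stars-readColumn : ∀ {n} (D : Diagram n) S c xs →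
    stars (readColumn D S c xs) ≡ Σℕ xs (λ i → if lookup S i then ind (D i c) else 0)
  stars-readColumn D S c [] = refl
  stars-readColumn D S c (x ∷ xs)
    rewrite stars-++ (wordAt D S c x) (readColumn D S c xs) | wordAt-cellSym D S c x
          | stars-readColumn D S c xs with D x c | lookup S x
  ... | true  | true  = refl
  ... | true  | false = refl
  ... | false | true  = refl
  ... | false | false = refl

  ΣIn-rowCount≤θ : ∀ {n} (D : Diagram n) S → ΣℕIn S (rowCount D) ≤ θ D S
  ΣIn-rowCount≤θ {n} D S = begin
      ΣℕIn S (rowCount D)
    ≡⟨ Σℕ-cong (allFin n) select-inside ⟩
      Σℕ (allFin n) (λ i → Σℕ (allFin n) (λ j → if lookup S i then ind (D i j) else 0))
    ≡⟨ Σℕ-swap (allFin n) (allFin n) _ ⟩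
      Σℕ (allFin n) (λ j → Σℕ (allFin n) (λ i → if lookup S i then ind (D i j) else 0))
    ≡⟨ Σℕ-cong (allFin n) (λ j → sym (stars-readColumn D S j (allFin n))) ⟩
      Σℕ (allFin n) (λ j → stars (word j D S))
    ≤⟨ Σℕ-mono (allFin n) (λ j → ℕP.m≤n+m (stars (word j D S)) (matched 0 (word j D S))) ⟩
      θ D S ∎
    where
    open ℕP.≤-Reasoning
    select-inside : ∀ i → (if lookup S i then rowCount D i else 0) ≡
                          Σℕ (allFin n) (λ j → if lookup S i then ind (D i j) else 0)
    select-inside i with lookup S i
    ... | true  = refl
    ... | false = sym (Σℕ-zero (allFin n) _ (All.universal (λ _ → refl) (allFin n)))

  size-cong : ∀ {n} (D E : Diagram n) → (∀ i j → E i j ≡ D i j) → size E ≡ size D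
  size-cong {n} D E E≡D = Σℕ-cong (allFin n) (λ i → Σℕ-cong (allFin n) (λ j → cong ind (E≡D i j)))

  θcol-cong : ∀ {n} (D E : Diagram n) S c → (∀ i → E i c ≡ D i c) → θcol E S c ≡ θcol D S c
  θcol-cong {n} D E S c E≡D =
    cong (Θ 0) (readColumn-cong D E S c (allFin n) (All.universal E≡D (allFin n)))

  θ-cong : ∀ {n} (D E : Diagram n) → (∀ i j → E i j ≡ D i j) → ∀ S → θ E S ≡ θ D S
  θ-cong {n} D E E≡D S = Σℕ-cong (allFin n) (λ c → θcol-cong D E S c (λ i → E≡D i c))

open ColumnWords

module MoveBoxCells where

  moveBox-otherColumn : ∀ {n} (D : Diagram n) r c r' i j → j ≢ c → moveBox D r c r' i j ≡ D i j
  moveBox-otherColumn D r c r' i j j≢c with j ≟ c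
  ... | yes j≡c = ⊥-elim (j≢c j≡c)
  ... | no _    = refl

  moveBox-otherRow : ∀ {n} (D : Diagram n) r c r' i j → i ≢ r → i ≢ r' → moveBox D r c r' i j ≡ D i j
  moveBox-otherRow D r c r' i j i≢r i≢r' with j ≟ c | i ≟ r | i ≟ r'
  ... | no _  | _       | _        = refl
  ... | yes _ | yes i≡r | _        = ⊥-elim (i≢r i≡r)
  ... | yes _ | no _    | yes i≡r' = ⊥-elim (i≢r' i≡r')
  ... | yes _ | no _    | no _     = refl

  moveBox-source : ∀ {n} (D : Diagram n) r c r' → moveBox D r c r' r c ≡ false
  moveBox-source D r c r' rewrite ≡-≟-identity _≟_ {c} refl | ≡-≟-identity _≟_ {r} refl = refl

  moveBox-target : ∀ {n} (D : Diagram n) r c r' → r' ≢ r → moveBox D r c r' r' c ≡ true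
  moveBox-target D r c r' r'≢r
    rewrite ≡-≟-identity _≟_ {c} refl | ≢-≟-identity _≟_ r'≢r | ≡-≟-identity _≟_ {r'} refl = refl

open MoveBoxCells

module KohnertMoveInvariants {n} {D E : Diagram n} (mv : KohnertMove D E) where
  open import Data.Nat using (_+_; _≤_)
  open KohnertMove mv

  -- In column c, rows P above r', the block Q between r' and r (all boxes)
  -- and rows R below r are unchanged; only the cells r' and r swap.
  θcol-moved : ∀ S → θcol E S c ≤ θcol D S c
  θcol-moved S with allFin-around₂ r' r above
  ... | P , Q , R , allFin≡ , P<r' , Q-between , r<R = begin
      Θ 0 (readColumn E S c (allFin n))       ≡⟨ cong (Θ 0) (read E) ⟩
      Θ 0 (around E (E r' c) (E r c))          ≡⟨ cong₂ (λ a b → Θ 0 (around E a b)) E-r' E-r ⟩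
      Θ 0 (around E true false)                ≡⟨ cong (Θ 0) outside-unchanged ⟩
      Θ 0 (around D true false)                ≤⟨ Θ-kohnert-exchange (lookup S r') (lookup S r)
                                                    (readColumn D S c P) (readColumn D S c Q) (readColumn D S c R)
                                                    (readColumn-boxes D S c Q block) ⟩
      Θ 0 (around D false true)                ≡⟨ cong₂ (λ a b → Θ 0 (around D a b)) (sym empty) (sym box) ⟩
      Θ 0 (around D (D r' c) (D r c))          ≡⟨ cong (Θ 0) (sym (read D)) ⟩
      Θ 0 (readColumn D S c (allFin n))       ∎
    where
    open ℕP.≤-Reasoning
    around : Diagram n → Bool → Bool → List Sym
    around F a b = readColumn F S c P ++ (cellSym a (lookup S r') ++ (readColumn F S c Q ++
                     (cellSym b (lookup S r) ++ readColumn F S c R)))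
    read : ∀ F → readColumn F S c (allFin n) ≡ around F (F r' c) (F r c)
    read F = trans (cong (readColumn F S c) allFin≡) (readColumn-around₂ F S c P r' Q r R)
    E-r' : E r' c ≡ true
    E-r' = trans (result r' c) (moveBox-target D r c r' (FinP.<⇒≢ above))
    E-r : E r c ≡ false
    E-r = trans (result r c) (moveBox-source D r c r')
    block : All (λ i → D i c ≡ true) Q
    block = All.map (λ (r'<i , i<r) → largest _ r'<i i<r) Q-between
    unchanged : ∀ {i} → i ≢ r → i ≢ r' → E i c ≡ D i c
    unchanged {i} i≢r i≢r' = trans (result i c) (moveBox-otherRow D r c r' i c i≢r i≢r')
    outside-unchanged : around E true false ≡ around D true false
    outside-unchanged
      rewrite readColumn-cong D E S c P (All.map (λ i<r' → unchanged (FinP.<⇒≢ (FinP.<-trans i<r' above))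
                                                                  (FinP.<⇒≢ i<r')) P<r')
            | readColumn-cong D E S c Q (All.map (λ (r'<i , i<r) → unchanged (FinP.<⇒≢ i<r)
                                                                         (≢-sym (FinP.<⇒≢ r'<i))) Q-between)
            | readColumn-cong D E S c R (All.map (λ r<i → unchanged (≢-sym (FinP.<⇒≢ r<i))
                                                                  (≢-sym (FinP.<⇒≢ (FinP.<-trans above r<i)))) r<R)
      = refl

  θ-moved : ∀ S → θ E S ≤ θ D S
  θ-moved S = Σℕ-mono (allFin n) column
    where
    column : ∀ c' → θcol E S c' ≤ θcol D S c'
    column c' with c' ≟ c
    ... | yes refl  = θcol-moved S
    ... | no c'≢c   = ℕP.≤-reflexive (θcol-cong D E S c'
                        (λ i → trans (result i c') (moveBox-otherColumn D r c r' i c' c'≢c)))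

  cell-balance : ∀ i j → ind (E i j) + ind (⌊ i ≟ r ⌋ ∧ ⌊ j ≟ c ⌋) ≡ ind (D i j) + ind (⌊ i ≟ r' ⌋ ∧ ⌊ j ≟ c ⌋)
  cell-balance i j rewrite result i j with j ≟ c | i ≟ r | i ≟ r'
  ... | no _     | yes _    | yes _     = refl
  ... | no _     | yes _    | no _      = refl
  ... | no _     | no _     | yes _     = refl
  ... | no _     | no _     | no _      = refl
  ... | yes _    | yes i≡r  | yes i≡r'  = ⊥-elim (FinP.<⇒≢ above (trans (sym i≡r') i≡r))
  ... | yes refl | yes refl | no _      rewrite box   = refl
  ... | yes refl | no _     | yes refl  rewrite empty = refl
  ... | yes _    | no _     | no _      = refl

  row-balance : ∀ i → rowCount E i + ind ⌊ i ≟ r ⌋ ≡ rowCount D i + ind ⌊ i ≟ r' ⌋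
  row-balance i = begin
      rowCount E i + ind ⌊ i ≟ r ⌋
    ≡⟨ cong (rowCount E i +_) (sym (Σℕ-delta-if ⌊ i ≟ r ⌋ c)) ⟩
      rowCount E i + Σℕ (allFin n) (λ j → ind (⌊ i ≟ r ⌋ ∧ ⌊ j ≟ c ⌋))
    ≡⟨ sym (Σℕ-+ (allFin n) _ _) ⟩
      Σℕ (allFin n) (λ j → ind (E i j) + ind (⌊ i ≟ r ⌋ ∧ ⌊ j ≟ c ⌋))
    ≡⟨ Σℕ-cong (allFin n) (cell-balance i) ⟩
      Σℕ (allFin n) (λ j → ind (D i j) + ind (⌊ i ≟ r' ⌋ ∧ ⌊ j ≟ c ⌋))
    ≡⟨ Σℕ-+ (allFin n) _ _ ⟩
      rowCount D i + Σℕ (allFin n) (λ j → ind (⌊ i ≟ r' ⌋ ∧ ⌊ j ≟ c ⌋))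
    ≡⟨ cong (rowCount D i +_) (Σℕ-delta-if ⌊ i ≟ r' ⌋ c) ⟩
      rowCount D i + ind ⌊ i ≟ r' ⌋ ∎
    where open ≡-Reasoning

  size-moved : size E ≡ size D
  size-moved = ℕP.+-cancelʳ-≡ 1 (size E) (size D) (begin
      size E + 1
    ≡⟨ cong (size E +_) (sym (Σℕ-delta r)) ⟩
      size E + Σℕ (allFin n) (λ i → ind ⌊ i ≟ r ⌋)
    ≡⟨ sym (Σℕ-+ (allFin n) _ _) ⟩
      Σℕ (allFin n) (λ i → rowCount E i + ind ⌊ i ≟ r ⌋)
    ≡⟨ Σℕ-cong (allFin n) row-balance ⟩
      Σℕ (allFin n) (λ i → rowCount D i + ind ⌊ i ≟ r' ⌋)
    ≡⟨ Σℕ-+ (allFin n) _ _ ⟩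
      size D + Σℕ (allFin n) (λ i → ind ⌊ i ≟ r' ⌋)
    ≡⟨ cong (size D +_) (Σℕ-delta r') ⟩
      size D + 1 ∎)
    where open ≡-Reasoning

module KohnertDiagrams where
  open import Data.Nat using (_≤_)

  koh-invariants : ∀ {n} {w : Permutation′ n} {D} → Koh w D →
    size D ≡ size (rothe w) × (∀ S → θ D S ≤ θ (rothe w) S)
  koh-invariants {w = w} {D} (start D≡Dw) =
    size-cong (rothe w) D D≡Dw , λ S → ℕP.≤-reflexive (θ-cong (rothe w) D D≡Dw S)
  koh-invariants (step k mv) with koh-invariants k
  ... | size≡ , θ≤ = trans (size-moved mv) size≡ , λ S → ℕP.≤-trans (θ-moved mv S) (θ≤ S)
    where open KohnertMoveInvariants

  koh-weight-bounds : ∀ {n} {w : Permutation′ n} {D} → Koh w D →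
    Σℕ (allFin n) (wt D) ≡ size (rothe w) × (∀ S → ΣℕIn S (wt D) ≤ θ (rothe w) S)
  koh-weight-bounds {D = D} k with koh-invariants k
  ... | size≡ , θ≤ = size≡ , λ S → ℕP.≤-trans (ΣIn-rowCount≤θ D S) (θ≤ S)

open KohnertDiagrams

module RationalSums where
  open import Data.Integer using (+_)
  open import Data.Rational using (_+_; _*_; _≤_)
  open CommSemigroupProps (CommutativeMonoid.commutativeSemigroup ℚP.+-0-commutativeMonoid)
    using (interchange)

  Σq : {A : Set} → List A → (A → ℚ) → ℚ
  Σq xs f = Σℚ (map f xs)

  Σq-cong : {A : Set} (xs : List A) {f g : A → ℚ} → All (λ x → f x ≡ g x) xs → Σq xs f ≡ Σq xs g
  Σq-cong []       []             = refl
  Σq-cong (x ∷ xs) (fx≡gx ∷ same) = cong₂ _+_ fx≡gx (Σq-cong xs same)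

  Σq-mono : {A : Set} (xs : List A) {f g : A → ℚ} → All (λ x → f x ≤ g x) xs → Σq xs f ≤ Σq xs g
  Σq-mono []       []            = ℚP.≤-refl
  Σq-mono (x ∷ xs) (fx≤gx ∷ les) = ℚP.+-mono-≤ fx≤gx (Σq-mono xs les)

  Σq-zero : {A : Set} (xs : List A) → Σq xs (λ _ → 0ℚ) ≡ 0ℚ
  Σq-zero []       = refl
  Σq-zero (x ∷ xs) rewrite Σq-zero xs = ℚP.+-identityʳ 0ℚ

  Σq-+ : {A : Set} (xs : List A) (f g : A → ℚ) → Σq xs (λ x → f x + g x) ≡ Σq xs f + Σq xs g
  Σq-+ []       f g = sym (ℚP.+-identityʳ 0ℚ)
  Σq-+ (x ∷ xs) f g rewrite Σq-+ xs f g = interchange (f x) (g x) (Σq xs f) (Σq xs g)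

  Σq-*ˡ : {A : Set} (xs : List A) (l : ℚ) (f : A → ℚ) → Σq xs (λ x → l * f x) ≡ l * Σq xs f
  Σq-*ˡ []       l f = sym (ℚP.*-zeroʳ l)
  Σq-*ˡ (x ∷ xs) l f rewrite Σq-*ˡ xs l f = sym (ℚP.*-distribˡ-+ l (f x) (Σq xs f))

  Σq-*ʳ : {A : Set} (xs : List A) (f : A → ℚ) (l : ℚ) → Σq xs (λ x → f x * l) ≡ Σq xs f * l
  Σq-*ʳ []       f l = sym (ℚP.*-zeroˡ l)
  Σq-*ʳ (x ∷ xs) f l rewrite Σq-*ʳ xs f l = sym (ℚP.*-distribʳ-+ l (f x) (Σq xs f))

  ℕtoℚ-mkℚ : ∀ a → ℕtoℚ a ≡ mkℚ (+ a) 0 (Coprimality.sym (Coprimality.1-coprimeTo a))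
  ℕtoℚ-mkℚ a = ℚP.↥p/↧p≡p _

  ℕtoℚ-+ : ∀ a b → ℕtoℚ (a ℕ.+ b) ≡ ℕtoℚ a + ℕtoℚ b
  ℕtoℚ-+ a b rewrite ℕtoℚ-mkℚ a | ℕtoℚ-mkℚ b =
    cong (ℚ._/ 1) (cong₂ ℤ._+_ (sym (ℤP.*-identityʳ (+ a))) (sym (ℤP.*-identityʳ (+ b))))

  ℕtoℚ-mono : ∀ {a b} → a ℕ.≤ b → ℕtoℚ a ≤ ℕtoℚ b
  ℕtoℚ-mono {a} {b} a≤b rewrite ℕtoℚ-mkℚ a | ℕtoℚ-mkℚ b =
    *≤* (subst₂ ℤ._≤_ (sym (ℤP.*-identityʳ (+ a))) (sym (ℤP.*-identityʳ (+ b))) (ℤ.+≤+ a≤b))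

  Σq-ℕtoℚ : {A : Set} (xs : List A) (f : A → ℕ) → Σq xs (λ x → ℕtoℚ (f x)) ≡ ℕtoℚ (Σℕ xs f)
  Σq-ℕtoℚ []       f = refl
  Σq-ℕtoℚ (x ∷ xs) f rewrite Σq-ℕtoℚ xs f = sym (ℕtoℚ-+ (f x) (Σℕ xs f))

  nonneg-*-ℕtoℚ : ∀ l a → 0ℚ ≤ l → 0ℚ ≤ l * ℕtoℚ a
  nonneg-*-ℕtoℚ l a 0≤l = ℚP.≤-trans (ℚP.≤-reflexive (sym (ℚP.*-zeroʳ l)))
    (ℚP.*-monoˡ-≤-nonNeg l {{ℚ.nonNegative 0≤l}} (ℕtoℚ-mono {0} {a} z≤n))

open RationalSums

module Convexity {n : ℕ} {X : Set} (v : X → Fin n → ℕ) where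
  open import Data.Rational using (_+_; _*_; _≤_)

  combination : List (ℚ × X) → Fin n → ℚ
  combination comb i = Σq comb (λ p → proj₁ p * ℕtoℚ (v (proj₂ p) i))

  Σselect-combination : ∀ (s : Fin n → Bool) comb →
    Σq (allFin n) (λ i → if s i then combination comb i else 0ℚ) ≡
    Σq comb (λ p → proj₁ p * ℕtoℚ (Σℕ (allFin n) (λ i → if s i then v (proj₂ p) i else 0)))
  Σselect-combination s [] =
    trans (Σq-cong (allFin n) (All.universal (λ i → if-zero (s i)) (allFin n))) (Σq-zero (allFin n))
    where
    if-zero : ∀ b → (if b then 0ℚ else 0ℚ) ≡ 0ℚ
    if-zero true  = refl
    if-zero false = refl
  Σselect-combination s ((l , x) ∷ rest) = begin
      Σq (allFin n) (λ i → if s i then l * ℕtoℚ (v x i) + combination rest i else 0ℚ)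
    ≡⟨ Σq-cong (allFin n) (All.universal (λ i → if-+ (s i)) (allFin n)) ⟩
      Σq (allFin n) (λ i → l * ℕtoℚ (if s i then v x i else 0) + (if s i then combination rest i else 0ℚ))
    ≡⟨ Σq-+ (allFin n) _ _ ⟩
      Σq (allFin n) (λ i → l * ℕtoℚ (if s i then v x i else 0))
        + Σq (allFin n) (λ i → if s i then combination rest i else 0ℚ)
    ≡⟨ cong₂ _+_ (trans (Σq-*ˡ (allFin n) l _) (cong (l *_) (Σq-ℕtoℚ (allFin n) _)))
                 (Σselect-combination s rest) ⟩
      l * ℕtoℚ (Σℕ (allFin n) (λ i → if s i then v x i else 0))
        + Σq rest (λ p → proj₁ p * ℕtoℚ (Σℕ (allFin n) (λ i → if s i then v (proj₂ p) i else 0))) ∎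
    where
    open ≡-Reasoning
    if-+ : ∀ {i} b → (if b then l * ℕtoℚ (v x i) + combination rest i else 0ℚ) ≡
                     l * ℕtoℚ (if b then v x i else 0) + (if b then combination rest i else 0ℚ)
    if-+ true  = refl
    if-+ false = sym (trans (ℚP.+-identityʳ _) (ℚP.*-zeroʳ l))

  Admissible : ℕ → (Subset n → ℕ) → X → Set
  Admissible N b x = Σℕ (allFin n) (v x) ≡ N × (∀ S → ΣℕIn S (v x) ℕ.≤ b S)

  convex-combination-bounds : ∀ N b comb →
    All (λ p → (0ℚ ≤ proj₁ p) × Admissible N b (proj₂ p)) comb → Σq comb proj₁ ≡ 1ℚ →
    (∀ i → 0ℚ ≤ combination comb i)
    × ΣℚFin n (combination comb) ≡ ℕtoℚ N
    × (∀ S → ΣℚIn S (combination comb) ≤ ℕtoℚ (b S))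
  convex-combination-bounds N b comb points total≡1 = nonneg , total , bounded
    where
    scale-by-total : ∀ a → Σq comb (λ p → proj₁ p * ℕtoℚ a) ≡ ℕtoℚ a
    scale-by-total a = trans (Σq-*ʳ comb proj₁ (ℕtoℚ a)) (trans (cong (_* ℕtoℚ a) total≡1) (ℚP.*-identityˡ _))
    nonneg : ∀ i → 0ℚ ≤ combination comb i
    nonneg i = ℚP.≤-trans (ℚP.≤-reflexive (sym (Σq-zero comb)))
      (Σq-mono comb (All.map (λ {p} (0≤l , _) → nonneg-*-ℕtoℚ (proj₁ p) (v (proj₂ p) i) 0≤l) points))
    total : ΣℚFin n (combination comb) ≡ ℕtoℚ N
    total = begin
        ΣℚFin n (combination comb)
      ≡⟨ Σselect-combination (λ _ → true) comb ⟩
        Σq comb (λ p → proj₁ p * ℕtoℚ (Σℕ (allFin n) (v (proj₂ p))))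
      ≡⟨ Σq-cong comb (All.map (λ {p} (_ , (sum≡ , _)) → cong (λ a → proj₁ p * ℕtoℚ a) sum≡) points) ⟩
        Σq comb (λ p → proj₁ p * ℕtoℚ N)
      ≡⟨ scale-by-total N ⟩
        ℕtoℚ N ∎
      where open ≡-Reasoning
    bounded : ∀ S → ΣℚIn S (combination comb) ≤ ℕtoℚ (b S)
    bounded S = begin
        ΣℚIn S (combination comb)
      ≡⟨ Σselect-combination (lookup S) comb ⟩
        Σq comb (λ p → proj₁ p * ℕtoℚ (ΣℕIn S (v (proj₂ p))))
      ≤⟨ Σq-mono comb (All.map (λ {p} (0≤l , (_ , sub≤)) →
           ℚP.*-monoˡ-≤-nonNeg (proj₁ p) {{ℚ.nonNegative 0≤l}} (ℕtoℚ-mono (sub≤ S))) points) ⟩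
        Σq comb (λ p → proj₁ p * ℕtoℚ (b S))
      ≡⟨ scale-by-total (b S) ⟩
        ℕtoℚ (b S) ∎
      where open ℚP.≤-Reasoning

InSchubitope-pointwise : ∀ {n} (D : Diagram n) {α β : Fin n → ℚ} →
  (∀ i → α i ≡ β i) → InSchubitope D β → InSchubitope D α
InSchubitope-pointwise {n} D {α} α≡β (nonneg , total , bounded) =
  (λ i → subst (0ℚ ℚ.≤_) (sym (α≡β i)) (nonneg i)) ,
  trans (Σq-cong (allFin n) (All.universal α≡β (allFin n))) total ,
  λ S → subst (ℚ._≤ ℕtoℚ (θ D S))
          (sym (Σq-cong (allFin n) (All.universal (λ i → cong (λ a → if lookup S i then a else 0ℚ) (α≡β i)) (allFin n))))
          (bounded S)

proposition5p20 : ∀ (n : ℕ) (w : Permutation′ n) (α : Fin n → ℚ) →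
                    InNewtonKoh w α → InSchubitope (rothe w) α
proposition5p20 n w α (comb , members , weights≡1 , α≡combination) =
  InSchubitope-pointwise (rothe w) α≡combination
    (convex-combination-bounds (size (rothe w)) (θ (rothe w)) comb
      (All.map (λ (0≤l , inKoh) → 0≤l , koh-weight-bounds inKoh) members) weights≡1)
  where open Convexity (wt {n})
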